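{- Let $\phi$ be a finite forest with node set $N_\phi$, labelling $\ell_\phi:N_\phi\to\mathcal N\uplus\mathcal S$. Let $X_\phi=\{\ell_\phi(n)\in\mathcal N\mid n\in N_\phi\}$, $I=\{(n,A)\mid \ell_\phi(n)=A\in\mathcal S\}$ and $Q_\phi=\nu X_\phi.\prod_{(n,A)\in I}A$. Suppose: (1) for every $n\in N_\phi$, if $\ell_\phi(n)\in\mathcal S$ then $n$ has no children; (2) for all $n,n'\in N_\phi$, if $\ell_\phi(n)=\ell_\phi(n')\in\mathcal N$ then $n=n'$; (3) for every $n\in N_\phi$ with $\ell_\phi(n)=A\in\mathcal S$ and every $x\in X_\phi\cap\mathrm{fn}(A)$, there is a proper ancestor $n'$ of $n$ with $\ell_\phi(n')=x$. Then there is a $\pi$-term $Q$ with $\phi=\mathrm{forest}(Q)$ (up to isomorphism of labelled forests) and $Q\equiv Q_\phi$.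
   Context: $\mathcal N$ is an infinite set of names. $\pi$-terms: $P ::= \nu x.P \mid P_1\parallel P_2 \mid M \mid\, !M$, $M ::= \mathbf 0 \mid M+M \mid \pi.P$, $\pi ::= a(x)\mid \overline a\langle b\rangle \mid \tau$; $\mathcal S$ is the set of sequential terms (those of the form $M$ or $!M$); $\mathrm{fn}$ denotes free names. Structural congruence $\equiv$: smallest congruence containing $\alpha$-conversion of bound names, commutativity/associativity of $+$ and $\parallel$ with neutral $\mathbf 0$, $\nu x.\mathbf 0\equiv\mathbf 0$, $\nu x.\nu y.P\equiv\nu y.\nu x.P$, $!\mathbf 0\equiv\mathbf 0$, $!M\equiv M\parallel !M$, $P\parallel\nu a.Q\equiv\nu a.(P\parallel Q)$ if $a\notin\mathrm{fn}(P)$. $\nu X.P$ abbreviates a sequence of restrictions of the names in $X$. $\mathrm{forest}(Q)$ is the labelled forest: $\mathrm{forest}(\nu x.Q')$ is a root labelled $x$ with the roots of $\mathrm{forest}(Q')$ as children; $\mathrm{forest}(Q_1\parallel Q_2)$ is the disjoint union; for sequential $Q$ a single node labelled $Q$; $\mathrm{forest}(\mathbf 0)$ empty. -}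

module Defs where

open import Data.Nat using (ℕ; _≟_; _≡ᵇ_)
open import Data.Bool using (if_then_else_)
open import Data.List using (List; []; _∷_; _++_; filter)
open import Data.List.Membership.Propositional using (_∈_; _∉_)
open import Data.List.Relation.Binary.Permutation.Propositional using (_↭_)
open import Data.Sum using (_⊎_; inj₁; inj₂)
open import Data.Product using (_×_)
open import Data.Unit using (⊤)
open import Relation.Nullary using (¬?)
open import Relation.Binary.PropositionalEquality using (_≡_; _≢_)

Name : Set
Name = ℕ

-- π-terms
--   π ::= a(x) | ā⟨b⟩ | τ
--   M ::= 0 | M + M | π.P
--   P ::= νx.P | P ∥ P | M | !M

data Pre : Set where
  inp : Name → Name → Pre      -- a(x), x bound
  out : Name → Name → Pre
  tau : Pre

infixr 6 _⊕_
infixr 5 _∥_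
infixr 7 _∙_

data Sum : Set
data Proc : Set

data Sum where
  nil : Sum
  _⊕_ : Sum → Sum → Sum
  _∙_ : Pre → Proc → Sum

data Proc where
  ν    : Name → Proc → Proc
  _∥_  : Proc → Proc → Proc
  sum  : Sum → Proc
  bang : Sum → Proc

𝟘 : Proc
𝟘 = sum nil

-- Sequential terms 𝒮: those of the form M or !M.
data SeqT : Set where
  sseq  : Sum → SeqT
  sbang : Sum → SeqT

toProc : SeqT → Proc
toProc (sseq M)  = sum M
toProc (sbang M) = bang M

remove : Name → List Name → List Name
remove x = filter (λ y → ¬? (y ≟ x))

fnS : Sum → List Name
fnP : Proc → List Name

fnS nil = []
fnS (M ⊕ N) = fnS M ++ fnS N
fnS (inp a x ∙ P) = a ∷ remove x (fnP P)
fnS (out a b ∙ P) = a ∷ b ∷ fnP P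
fnS (tau ∙ P) = fnP P

fnP (ν x P) = remove x (fnP P)
fnP (P ∥ Q) = fnP P ++ fnP Q
fnP (sum M) = fnS M
fnP (bang M) = fnS M

fnSeq : SeqT → List Name
fnSeq A = fnP (toProc A)

namesS : Sum → List Name
namesP : Proc → List Name

namesS nil = []
namesS (M ⊕ N) = namesS M ++ namesS N
namesS (inp a x ∙ P) = a ∷ x ∷ namesP P
namesS (out a b ∙ P) = a ∷ b ∷ namesP P
namesS (tau ∙ P) = namesP P

namesP (ν x P) = x ∷ namesP P
namesP (P ∥ Q) = namesP P ++ namesP Q
namesP (sum M) = namesS M
namesP (bang M) = namesS M

-- Renaming of the free occurrences of x by y:  P{y/x}
-- (used only with y fresh for P, so no capture can occur)

module _ (y x : Name) where
  renN : Name → Name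
  renN z = if z ≡ᵇ x then y else z

  renS : Sum → Sum
  renP : Proc → Proc

  renS nil = nil
  renS (M ⊕ N) = renS M ⊕ renS N
  renS (inp a z ∙ P) = inp (renN a) z ∙ (if z ≡ᵇ x then P else renP P)
  renS (out a b ∙ P) = out (renN a) (renN b) ∙ renP P
  renS (tau ∙ P) = tau ∙ renP P

  renP (ν z P) = if z ≡ᵇ x then ν z P else ν z (renP P)
  renP (P ∥ Q) = renP P ∥ renP Q
  renP (sum M) = sum (renS M)
  renP (bang M) = bang (renS M)

infix 4 _≈S_ _≈P_

data _≈S_ : Sum → Sum → Set
data _≈P_ : Proc → Proc → Set

data _≈S_ where
  reflS  : ∀ {M} → M ≈S M
  symS   : ∀ {M N} → M ≈S N → N ≈S M
  transS : ∀ {M N K} → M ≈S N → N ≈S K → M ≈S K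
  ⊕-cong : ∀ {M M′ N N′} → M ≈S M′ → N ≈S N′ → M ⊕ N ≈S M′ ⊕ N′
  ∙-cong : ∀ {π P Q} → P ≈P Q → π ∙ P ≈S π ∙ Q
  α-inp  : ∀ {a x y P} → y ∉ namesP P → inp a x ∙ P ≈S inp a y ∙ renP y x P
  ⊕-comm  : ∀ {M N} → M ⊕ N ≈S N ⊕ M
  ⊕-assoc : ∀ {M N K} → (M ⊕ N) ⊕ K ≈S M ⊕ (N ⊕ K)
  ⊕-unit  : ∀ {M} → M ⊕ nil ≈S M

data _≈P_ where
  reflP  : ∀ {P} → P ≈P P
  symP   : ∀ {P Q} → P ≈P Q → Q ≈P P
  transP : ∀ {P Q R} → P ≈P Q → Q ≈P R → P ≈P R
  ν-cong    : ∀ {x P Q} → P ≈P Q → ν x P ≈P ν x Q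
  ∥-cong    : ∀ {P P′ Q Q′} → P ≈P P′ → Q ≈P Q′ → P ∥ Q ≈P P′ ∥ Q′
  sum-cong  : ∀ {M N} → M ≈S N → sum M ≈P sum N
  bang-cong : ∀ {M N} → M ≈S N → bang M ≈P bang N
  α-ν : ∀ {x y P} → y ∉ namesP P → ν x P ≈P ν y (renP y x P)
  ∥-comm  : ∀ {P Q} → P ∥ Q ≈P Q ∥ P
  ∥-assoc : ∀ {P Q R} → (P ∥ Q) ∥ R ≈P P ∥ (Q ∥ R)
  ∥-unit  : ∀ {P} → P ∥ 𝟘 ≈P P
  ν-nil   : ∀ {x} → ν x 𝟘 ≈P 𝟘
  ν-swap  : ∀ {x y P} → ν x (ν y P) ≈P ν y (ν x P)
  bang-nil : bang nil ≈P 𝟘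
  bang-unf : ∀ {M} → bang M ≈P sum M ∥ bang M
  scope    : ∀ {a P Q} → a ∉ fnP P → P ∥ ν a Q ≈P ν a (P ∥ Q)

Label : Set
Label = Name ⊎ SeqT

data Tree : Set where
  node : Label → List Tree → Tree

Forest : Set
Forest = List Tree

forest : Proc → Forest
forest (ν x Q) = node (inj₁ x) (forest Q) ∷ []
forest (P ∥ Q) = forest P ++ forest Q
forest (sum nil) = []
forest (sum (M ⊕ N)) = node (inj₂ (sseq (M ⊕ N))) [] ∷ []
forest (sum (π ∙ P)) = node (inj₂ (sseq (π ∙ P))) [] ∷ []
forest (bang M) = node (inj₂ (sbang M)) [] ∷ []

infix 4 _≅T_ _≅F_

data _≅T_ : Tree → Tree → Set
data _≅F_ : Forest → Forest → Set

data _≅T_ where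
  node : ∀ {l ts us} → ts ≅F us → node l ts ≅T node l us

data _≅F_ where
  iso-[] : [] ≅F []
  iso-∷  : ∀ {t u ts us} → t ≅T u → ts ≅F us → t ∷ ts ≅F u ∷ us
  perm : ∀ {ts us vs} → ts ≅F us → us ↭ vs → ts ≅F vs

-- the list of name labels (one entry per name-labelled node)
nameLabelsT : Tree → List Name
nameLabelsF : Forest → List Name
nameLabelsT (node (inj₁ x) ts) = x ∷ nameLabelsF ts
nameLabelsT (node (inj₂ A) ts) = nameLabelsF ts
nameLabelsF [] = []
nameLabelsF (t ∷ ts) = nameLabelsT t ++ nameLabelsF ts

-- the list of sequential labels (one entry per node (n, A) ∈ I)
seqLabelsT : Tree → List SeqT
seqLabelsF : Forest → List SeqT
seqLabelsT (node (inj₁ x) ts) = seqLabelsF ts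
seqLabelsT (node (inj₂ A) ts) = A ∷ seqLabelsF ts
seqLabelsF [] = []
seqLabelsF (t ∷ ts) = seqLabelsT t ++ seqLabelsF ts

nus : List Name → Proc → Proc
nus [] P = P
nus (x ∷ xs) P = ν x (nus xs P)

prod : List SeqT → Proc
prod [] = 𝟘
prod (A ∷ As) = toProc A ∥ prod As

Qφ : Forest → Proc
Qφ φ = nus (nameLabelsF φ) (prod (seqLabelsF φ))

SeqLeafT : Tree → Set
SeqLeafF : Forest → Set
SeqLeafT (node (inj₁ x) ts) = SeqLeafF ts
SeqLeafT (node (inj₂ A) ts) = ts ≡ []
SeqLeafF [] = ⊤
SeqLeafF (t ∷ ts) = SeqLeafT t × SeqLeafF ts

-- (3) every x ∈ X ∩ fn(A) of a sequential node labelled A is the label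
--     of a proper ancestor; `anc` is the list of labels of the proper
--     ancestors (name-labelled ones) of the current position.
ScopedT : List Name → List Name → Tree → Set
ScopedF : List Name → List Name → Forest → Set
ScopedT X anc (node (inj₁ x) ts) = ScopedF X (x ∷ anc) ts
ScopedT X anc (node (inj₂ A) ts) =
  (∀ x → x ∈ X → x ∈ fnSeq A → x ∈ anc) × ScopedF X anc ts
ScopedF X anc [] = ⊤
ScopedF X anc (t ∷ ts) = ScopedT X anc t × ScopedF X anc ts

NoNilT : Tree → Set
NoNilF : Forest → Set
NoNilT (node (inj₁ x) ts) = NoNilF ts
NoNilT (node (inj₂ A) ts) = (A ≢ sseq nil) × NoNilF ts
NoNilF [] = ⊤
NoNilF (t ∷ ts) = NoNilT t × NoNilF ts

module Submission where

open import Defs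
open import Data.Product using (_×_; ∃-syntax; _,_)
open import Data.List using (List; []; _∷_; _++_)
open import Data.List.Relation.Unary.Unique.Propositional using (Unique)
open import Data.List.Relation.Unary.AllPairs using ([]; _∷_)
open import Data.List.Relation.Unary.All using (lookup)
open import Data.List.Relation.Unary.All.Properties using (++⁻ˡ; ++⁻ʳ)
open import Data.List.Relation.Unary.Any using (here; there)
open import Data.List.Relation.Binary.Disjoint.Propositional using (Disjoint)
open import Data.List.Relation.Binary.Subset.Propositional using (_⊆_)
open import Data.List.Membership.Propositional using (_∈_)
open import Data.List.Membership.Propositional.Properties using (∈-++⁺ˡ; ∈-++⁺ʳ; ∈-++⁻; ∈-filter⁻)
open import Data.Sum using (_⊎_; inj₁; inj₂)
open import Data.Empty using (⊥-elim)
open import Relation.Binary.PropositionalEquality using (_≡_; refl; sym; cong; cong₂; subst)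

-- The witness Q reads φ back as a term: a name node x becomes ν x over the
-- parallel composition of its children, a leaf A becomes A itself.  By (1)
-- and the absence of 0-labels, forest(Q) is φ on the nose.  To reach Q_φ,
-- all restrictions are extruded to the top, one parallel component at a
-- time.  Extruding the names N of one component past a sibling S needs
-- N ∩ fn(S) = ∅: a restricted name free in a leaf of S is, by (3), the
-- label of an ancestor of that leaf, hence an ancestor of the common
-- parent or a node of S itself, and by (2) neither can carry a name of N.

termT : Tree → Proc
termF : Forest → Proc
termT (node (inj₁ x) ts) = ν x (termF ts)
termT (node (inj₂ A) ts) = toProc A
termF [] = 𝟘
termF (t ∷ ts) = termT t ∥ termF ts

forest-termT : ∀ t → NoNilT t → SeqLeafT t → forest (termT t) ≡ t ∷ []
forest-termF : ∀ ts → NoNilF ts → SeqLeafF ts → forest (termF ts) ≡ ts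
forest-termT (node (inj₁ x) ts) nn sl = cong (λ us → node (inj₁ x) us ∷ []) (forest-termF ts nn sl)
forest-termT (node (inj₂ (sseq nil)) ts) (A≢0 , _) refl = ⊥-elim (A≢0 refl)
forest-termT (node (inj₂ (sseq (M ⊕ N))) ts) _ refl = refl
forest-termT (node (inj₂ (sseq (π ∙ P))) ts) _ refl = refl
forest-termT (node (inj₂ (sbang M)) ts) _ refl = refl
forest-termF [] _ _ = refl
forest-termF (t ∷ ts) (nn , nns) (sl , sls) = cong₂ _++_ (forest-termT t nn sl) (forest-termF ts nns sls)

≅T-refl : ∀ t → t ≅T t
≅F-refl : ∀ ts → ts ≅F ts
≅T-refl (node l ts) = node (≅F-refl ts)
≅F-refl [] = iso-[]
≅F-refl (t ∷ ts) = iso-∷ (≅T-refl t) (≅F-refl ts)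

Unique-++⁻ : ∀ {A : Set} (xs : List A) {ys} → Unique (xs ++ ys) → Unique xs × Unique ys × Disjoint xs ys
Unique-++⁻ [] u = [] , u , λ ()
Unique-++⁻ (x ∷ xs) (x∉ ∷ u) with Unique-++⁻ xs u
... | uxs , uys , xs#ys = (++⁻ˡ xs x∉ ∷ uxs) , uys , x∷xs#ys
  where
  x∷xs#ys : Disjoint (x ∷ xs) _
  x∷xs#ys (here refl , y∈ys) = lookup (++⁻ʳ xs x∉) y∈ys refl
  x∷xs#ys (there y∈xs , y∈ys) = xs#ys (y∈xs , y∈ys)

fn-nus : ∀ B P → fnP (nus B P) ⊆ fnP P
fn-nus [] P x∈ = x∈
fn-nus (b ∷ B) P x∈ with ∈-filter⁻ _ x∈
... | x∈′ , _ = fn-nus B P x∈′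

fn-prod⁻ : ∀ S {x} → x ∈ fnP (prod S) → ∃[ A ] A ∈ S × x ∈ fnSeq A
fn-prod⁻ (A ∷ S) x∈ with ∈-++⁻ (fnSeq A) x∈
... | inj₁ x∈A = A , here refl , x∈A
... | inj₂ x∈S with fn-prod⁻ S x∈S
... | B , B∈S , x∈B = B , there B∈S , x∈B

module _ {X : List Name} {x : Name} (x∈X : x ∈ X) where

  seqLabel-scopedT : ∀ {anc} t → ScopedT X anc t → ∀ {A} → A ∈ seqLabelsT t → x ∈ fnSeq A
                   → x ∈ anc ⊎ x ∈ nameLabelsT t
  seqLabel-scopedF : ∀ {anc} ts → ScopedF X anc ts → ∀ {A} → A ∈ seqLabelsF ts → x ∈ fnSeq A
                   → x ∈ anc ⊎ x ∈ nameLabelsF ts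
  seqLabel-scopedT (node (inj₁ y) ts) s A∈ x∈A with seqLabel-scopedF ts s A∈ x∈A
  ... | inj₁ (here x≡y) = inj₂ (here x≡y)
  ... | inj₁ (there x∈anc) = inj₁ x∈anc
  ... | inj₂ x∈ts = inj₂ (there x∈ts)
  seqLabel-scopedT (node (inj₂ B) ts) (scB , _) (here refl) x∈A = inj₁ (scB x x∈X x∈A)
  seqLabel-scopedT (node (inj₂ B) ts) (_ , s) (there A∈) x∈A = seqLabel-scopedF ts s A∈ x∈A
  seqLabel-scopedF (t ∷ ts) (s , ss) A∈ x∈A with ∈-++⁻ (seqLabelsT t) A∈
  ... | inj₁ A∈t with seqLabel-scopedT t s A∈t x∈A
  ...   | inj₁ x∈anc = inj₁ x∈anc
  ...   | inj₂ x∈t = inj₂ (∈-++⁺ˡ x∈t)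
  seqLabel-scopedF (t ∷ ts) (s , ss) A∈ x∈A | inj₂ A∈ts with seqLabel-scopedF ts ss A∈ts x∈A
  ...   | inj₁ x∈anc = inj₁ x∈anc
  ...   | inj₂ x∈ts = inj₂ (∈-++⁺ʳ (nameLabelsT t) x∈ts)

  fn-prod-scopedT : ∀ {anc} t → ScopedT X anc t → x ∈ fnP (prod (seqLabelsT t))
                  → x ∈ anc ⊎ x ∈ nameLabelsT t
  fn-prod-scopedT t s x∈ with fn-prod⁻ (seqLabelsT t) x∈
  ... | A , A∈ , x∈A = seqLabel-scopedT t s A∈ x∈A

  fn-prod-scopedF : ∀ {anc} ts → ScopedF X anc ts → x ∈ fnP (prod (seqLabelsF ts))
                  → x ∈ anc ⊎ x ∈ nameLabelsF ts
  fn-prod-scopedF ts s x∈ with fn-prod⁻ (seqLabelsF ts) x∈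
  ... | A , A∈ , x∈A = seqLabel-scopedF ts s A∈ x∈A

nus-cong : ∀ A {P Q} → P ≈P Q → nus A P ≈P nus A Q
nus-cong [] P≈Q = P≈Q
nus-cong (a ∷ A) P≈Q = ν-cong (nus-cong A P≈Q)

nus-++ : ∀ A B P → nus (A ++ B) P ≡ nus A (nus B P)
nus-++ [] B P = refl
nus-++ (a ∷ A) B P = cong (ν a) (nus-++ A B P)

nus-scopeʳ : ∀ B P Q → Disjoint B (fnP P) → P ∥ nus B Q ≈P nus B (P ∥ Q)
nus-scopeʳ [] P Q B#P = reflP
nus-scopeʳ (b ∷ B) P Q B#P =
  transP (scope (λ b∈P → B#P (here refl , b∈P)))
         (ν-cong (nus-scopeʳ B P Q (λ (b∈B , b∈P) → B#P (there b∈B , b∈P))))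

nus-scopeˡ : ∀ A P R → Disjoint A (fnP R) → nus A P ∥ R ≈P nus A (P ∥ R)
nus-scopeˡ A P R A#R = transP ∥-comm (transP (nus-scopeʳ A R P A#R) (nus-cong A ∥-comm))

nus-∥-nus : ∀ A B P Q → Disjoint A (fnP (nus B Q)) → Disjoint B (fnP P)
          → nus A P ∥ nus B Q ≈P nus (A ++ B) (P ∥ Q)
nus-∥-nus A B P Q A#Q B#P =
  transP (nus-scopeˡ A P (nus B Q) A#Q)
         (subst (nus A (P ∥ nus B Q) ≈P_) (sym (nus-++ A B (P ∥ Q)))
                (nus-cong A (nus-scopeʳ B P Q B#P)))

prod-++ : ∀ S T → prod (S ++ T) ≈P prod S ∥ prod T
prod-++ [] T = symP (transP ∥-comm ∥-unit)
prod-++ (A ∷ S) T = transP (∥-cong reflP (prod-++ S T)) (symP ∥-assoc)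

QT : Tree → Proc
QT t = nus (nameLabelsT t) (prod (seqLabelsT t))

termT≈QT : ∀ {X} anc t → SeqLeafT t → Unique (nameLabelsT t) → Disjoint (nameLabelsT t) anc
         → nameLabelsT t ⊆ X → ScopedT X anc t → termT t ≈P QT t
termF≈Qφ : ∀ {X} anc ts → SeqLeafF ts → Unique (nameLabelsF ts) → Disjoint (nameLabelsF ts) anc
         → nameLabelsF ts ⊆ X → ScopedF X anc ts → termF ts ≈P Qφ ts
termT≈QT anc (node (inj₁ y) ts) sl (y∉ts ∷ u) ts#anc ts⊆X s =
  ν-cong (termF≈Qφ (y ∷ anc) ts sl u ts#y∷anc (λ x∈ → ts⊆X (there x∈)) s)
  where
  ts#y∷anc : Disjoint (nameLabelsF ts) (y ∷ anc)
  ts#y∷anc (x∈ts , here refl) = lookup y∉ts x∈ts refl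
  ts#y∷anc (x∈ts , there x∈anc) = ts#anc (there x∈ts , x∈anc)
termT≈QT anc (node (inj₂ A) .[]) refl _ _ _ _ = symP ∥-unit
termF≈Qφ anc [] _ _ _ _ _ = reflP
termF≈Qφ anc (t ∷ ts) (sl , sls) u t∷ts#anc t∷ts⊆X (s , ss) with Unique-++⁻ (nameLabelsT t) u
... | ut , uts , t#ts =
  transP (∥-cong (termT≈QT anc t sl ut t#anc (λ x∈ → t∷ts⊆X (inT x∈)) s)
                 (termF≈Qφ anc ts sls uts ts#anc (λ x∈ → t∷ts⊆X (inTs x∈)) ss))
  (transP (nus-∥-nus (nameLabelsT t) (nameLabelsF ts) _ _ t#Qts ts#St)
          (nus-cong (nameLabelsT t ++ nameLabelsF ts) (symP (prod-++ (seqLabelsT t) (seqLabelsF ts)))))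
  where
  inT : nameLabelsT t ⊆ nameLabelsF (t ∷ ts)
  inT = ∈-++⁺ˡ
  inTs : nameLabelsF ts ⊆ nameLabelsF (t ∷ ts)
  inTs = ∈-++⁺ʳ (nameLabelsT t)
  t#anc : Disjoint (nameLabelsT t) anc
  t#anc (x∈t , x∈anc) = t∷ts#anc (inT x∈t , x∈anc)
  ts#anc : Disjoint (nameLabelsF ts) anc
  ts#anc (x∈ts , x∈anc) = t∷ts#anc (inTs x∈ts , x∈anc)
  t#Qts : Disjoint (nameLabelsT t) (fnP (Qφ ts))
  t#Qts (x∈t , x∈Qts) with fn-prod-scopedF (t∷ts⊆X (inT x∈t)) ts ss (fn-nus (nameLabelsF ts) _ x∈Qts)
  ... | inj₁ x∈anc = t#anc (x∈t , x∈anc)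
  ... | inj₂ x∈ts = t#ts (x∈t , x∈ts)
  ts#St : Disjoint (nameLabelsF ts) (fnP (prod (seqLabelsT t)))
  ts#St (x∈ts , x∈St) with fn-prod-scopedT (t∷ts⊆X (inTs x∈ts)) t s x∈St
  ... | inj₁ x∈anc = ts#anc (x∈ts , x∈anc)
  ... | inj₂ x∈t = t#ts (x∈t , x∈ts)

lemma1 : (φ : Forest)
    → NoNilF φ
    → SeqLeafF φ
    → Unique (nameLabelsF φ)
    → ScopedF (nameLabelsF φ) [] φ
    → ∃[ Q ] ((φ ≅F forest Q) × (Q ≈P Qφ φ))
lemma1 φ nn sl u s =
  termF φ ,
  subst (φ ≅F_) (sym (forest-termF φ nn sl)) (≅F-refl φ) ,
  termF≈Qφ [] φ sl u (λ ()) (λ x∈ → x∈) s
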